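{- Let $n\ge 3$, $k_1,k_2\in N$ and let $\tau,\nu$ be H-cycles in $N$. If $k_1\ne k_2$ or $\tau\ne\nu$, then $S_{k_1}^{(\tau)}\ne S_{k_2}^{(\nu)}$.
   Context: Let $N=\{1,\dots,n\}$. A Hamiltonian cycle (H-cycle) in $N$ is a cyclic sequence $\tau=\tau_1\tau_2\cdots\tau_n\tau_1$ where $\tau_1\cdots\tau_n$ is a permutation of $N$; it may be listed starting at any of its indices (cyclic shifts represent the same H-cycle), while the reversed sequence is a different H-cycle. For an H-cycle $\tau$ and $k\in N$, list $\tau=\tau_1\cdots\tau_n\tau_1$ with $\tau_1=k$ and define $S_k^{(\tau)}=\{(\tau_i,\tau_j): 1\le i<j\le n\}\subseteq N\times N$. -}

module Defs where

open import Data.Nat using (ℕ; suc; _+_; _≥_)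
open import Data.Nat.DivMod using (_mod_)
open import Data.Fin using (Fin; toℕ; _<_)
open import Data.Fin.Permutation using (Permutation′; _⟨$⟩ʳ_; _⟨$⟩ˡ_)
open import Data.Product using (Σ; ∃; _×_; _,_)
open import Relation.Binary.PropositionalEquality using (_≡_)

-- N = {1,…,n} is modelled by Fin n (element i ↔ i+1); we only treat n ≥ 1
-- as `suc m` so that arithmetic mod n is available.

-- A listing τ₁ ⋯ τₙ of an H-cycle: a permutation; listing τ (i) = τ_{i+1}.
Listing : ℕ → Set
Listing n = Permutation′ n

shiftPos : {m : ℕ} → Fin (suc m) → Fin (suc m) → Fin (suc m)
shiftPos {m} i r = (toℕ i + toℕ r) mod (suc m)

at : {m : ℕ} → Listing (suc m) → Fin (suc m) → Fin (suc m)
at τ i = τ ⟨$⟩ʳ i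

-- H-cycles are listings modulo cyclic shift; two listings represent the
-- same H-cycle iff one is a cyclic shift of the other.
SameHCycle : {m : ℕ} → Listing (suc m) → Listing (suc m) → Set
SameHCycle {m} τ ν = Σ (Fin (suc m)) λ r → ∀ i → at τ i ≡ at ν (shiftPos i r)

startAt : {m : ℕ} → Listing (suc m) → Fin (suc m) → Fin (suc m) → Fin (suc m)
startAt τ k i = at τ (shiftPos i (τ ⟨$⟩ˡ k))

S : {m : ℕ} → Listing (suc m) → Fin (suc m) → Fin (suc m) → Fin (suc m) → Set
S {m} τ k a b = Σ (Fin (suc m)) λ i → Σ (Fin (suc m)) λ j →
  (i < j) × (startAt τ k i ≡ a) × (startAt τ k j ≡ b)

SameSet : {m : ℕ} → (Fin (suc m) → Fin (suc m) → Set) → (Fin (suc m) → Fin (suc m) → Set) → Set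
SameSet {m} P Q = ∀ a b → (P a b → Q a b) × (Q a b → P a b)

-- Listing τ from k is a bijection σ = startAt τ k from positions to N, and S_k^(τ) is the
-- precedence relation of σ.  If two such bijections σ, ρ have the same precedence relation,
-- then ρ⁻¹ ∘ σ and σ⁻¹ ∘ ρ are mutually inverse strictly increasing maps of Fin n, hence
-- both the identity, so σ = ρ.  Reading off position 0 gives k₁ = k₂, and comparing the two
-- rotations shows that τ and ν differ by a cyclic shift.
module Submission where

open import Defs
open import Data.Nat using (ℕ; suc; _≥_; _+_; _∸_; _%_; z≤n; NonZero)
import Data.Nat as ℕ
open import Data.Nat.Properties using (+-assoc; +-comm; m+[n∸m]≡n; ≤-antisym; ≤-refl; ≤-<-trans; <⇒≤)
open import Data.Nat.DivMod using (_mod_; %-distribˡ-+; m%n%n≡m%n; n%n≡0; m<n⇒m%n≡m; m%n<n)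
open import Data.Fin using (Fin; zero; suc; toℕ; inject₁; _<_)
open import Data.Fin.Induction using (<-weakInduction)
open import Data.Fin.Properties using (toℕ-injective; toℕ<n; toℕ-fromℕ<; toℕ-inject₁; ≤̄⇒inject₁<)
open import Data.Fin.Permutation using (Permutation′; permutation; _⟨$⟩ʳ_; _⟨$⟩ˡ_; _∘ₚ_; _≈_; inverseˡ; inverseʳ)
open import Data.Product using (Σ; _×_; _,_; proj₁; proj₂)
open import Data.Sum using (_⊎_; [_,_])
open import Relation.Nullary using (¬_)
open import Relation.Binary.Core using (_Preserves_⟶_)
open import Relation.Binary.PropositionalEquality
  using (_≡_; refl; sym; trans; cong; subst; subst₂; module ≡-Reasoning)

[m%d+n]%d≡[m+n]%d : ∀ m n d .{{_ : NonZero d}} → (m % d + n) % d ≡ (m + n) % d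
[m%d+n]%d≡[m+n]%d m n d = begin
  (m % d + n) % d         ≡⟨ %-distribˡ-+ (m % d) n d ⟩
  (m % d % d + n % d) % d ≡⟨ cong (λ x → (x + n % d) % d) (m%n%n≡m%n m d) ⟩
  (m % d + n % d) % d     ≡⟨ sym (%-distribˡ-+ m n d) ⟩
  (m + n) % d             ∎
  where open ≡-Reasoning

[m+n%d]%d≡[m+n]%d : ∀ m n d .{{_ : NonZero d}} → (m + n % d) % d ≡ (m + n) % d
[m+n%d]%d≡[m+n]%d m n d = begin
  (m + n % d) % d ≡⟨ cong (_% d) (+-comm m (n % d)) ⟩
  (n % d + m) % d ≡⟨ [m%d+n]%d≡[m+n]%d n m d ⟩
  (n + m) % d     ≡⟨ cong (_% d) (+-comm n m) ⟩
  (m + n) % d     ∎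
  where open ≡-Reasoning

module _ {m : ℕ} where

  infixl 6 _⊕_
  _⊕_ : Fin (suc m) → Fin (suc m) → Fin (suc m)
  _⊕_ = shiftPos

  ⊖_ : Fin (suc m) → Fin (suc m)
  ⊖ a = (suc m ∸ toℕ a) mod suc m

  toℕ-⊕ : ∀ i r → toℕ (i ⊕ r) ≡ (toℕ i + toℕ r) % suc m
  toℕ-⊕ i r = toℕ-fromℕ< (m%n<n (toℕ i + toℕ r) (suc m))

  ⊕-comm : ∀ i r → i ⊕ r ≡ r ⊕ i
  ⊕-comm i r = cong (_mod suc m) (+-comm (toℕ i) (toℕ r))

  ⊕-identityˡ : ∀ a → zero ⊕ a ≡ a
  ⊕-identityˡ a = toℕ-injective (trans (toℕ-⊕ zero a) (m<n⇒m%n≡m (toℕ<n a)))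

  ⊕-identityʳ : ∀ a → a ⊕ zero ≡ a
  ⊕-identityʳ a = trans (⊕-comm a zero) (⊕-identityˡ a)

  ⊕-assoc : ∀ i r s → (i ⊕ r) ⊕ s ≡ i ⊕ (r ⊕ s)
  ⊕-assoc i r s = toℕ-injective (begin
    toℕ ((i ⊕ r) ⊕ s)                         ≡⟨ toℕ-⊕ (i ⊕ r) s ⟩
    (toℕ (i ⊕ r) + toℕ s) % suc m             ≡⟨ cong (λ x → (x + toℕ s) % suc m) (toℕ-⊕ i r) ⟩
    ((toℕ i + toℕ r) % suc m + toℕ s) % suc m ≡⟨ [m%d+n]%d≡[m+n]%d (toℕ i + toℕ r) (toℕ s) (suc m) ⟩
    (toℕ i + toℕ r + toℕ s) % suc m           ≡⟨ cong (_% suc m) (+-assoc (toℕ i) (toℕ r) (toℕ s)) ⟩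
    (toℕ i + (toℕ r + toℕ s)) % suc m         ≡⟨ [m+n%d]%d≡[m+n]%d (toℕ i) (toℕ r + toℕ s) (suc m) ⟨
    (toℕ i + (toℕ r + toℕ s) % suc m) % suc m ≡⟨ cong (λ x → (toℕ i + x) % suc m) (toℕ-⊕ r s) ⟨
    (toℕ i + toℕ (r ⊕ s)) % suc m             ≡⟨ toℕ-⊕ i (r ⊕ s) ⟨
    toℕ (i ⊕ (r ⊕ s))                         ∎)
    where open ≡-Reasoning

  toℕ-⊖ : ∀ a → toℕ (⊖ a) ≡ (suc m ∸ toℕ a) % suc m
  toℕ-⊖ a = toℕ-fromℕ< (m%n<n (suc m ∸ toℕ a) (suc m))

  ⊕-inverseʳ : ∀ a → a ⊕ ⊖ a ≡ zero
  ⊕-inverseʳ a = toℕ-injective (begin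
    toℕ (a ⊕ ⊖ a)                               ≡⟨ toℕ-⊕ a (⊖ a) ⟩
    (toℕ a + toℕ (⊖ a)) % suc m                 ≡⟨ cong (λ x → (toℕ a + x) % suc m) (toℕ-⊖ a) ⟩
    (toℕ a + (suc m ∸ toℕ a) % suc m) % suc m   ≡⟨ [m+n%d]%d≡[m+n]%d (toℕ a) (suc m ∸ toℕ a) (suc m) ⟩
    (toℕ a + (suc m ∸ toℕ a)) % suc m           ≡⟨ cong (_% suc m) (m+[n∸m]≡n (<⇒≤ (toℕ<n a))) ⟩
    suc m % suc m                               ≡⟨ n%n≡0 (suc m) ⟩
    0                                           ∎)
    where open ≡-Reasoning

  ⊕-⊖-cancelʳ : ∀ i a → i ⊕ ⊖ a ⊕ a ≡ i
  ⊕-⊖-cancelʳ i a = begin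
    i ⊕ ⊖ a ⊕ a     ≡⟨ ⊕-assoc i (⊖ a) a ⟩
    i ⊕ (⊖ a ⊕ a)   ≡⟨ cong (i ⊕_) (trans (⊕-comm (⊖ a) a) (⊕-inverseʳ a)) ⟩
    i ⊕ zero        ≡⟨ ⊕-identityʳ i ⟩
    i               ∎
    where open ≡-Reasoning

  ⊖-⊕-cancelʳ : ∀ i a → i ⊕ a ⊕ ⊖ a ≡ i
  ⊖-⊕-cancelʳ i a = begin
    i ⊕ a ⊕ ⊖ a     ≡⟨ ⊕-assoc i a (⊖ a) ⟩
    i ⊕ (a ⊕ ⊖ a)   ≡⟨ cong (i ⊕_) (⊕-inverseʳ a) ⟩
    i ⊕ zero        ≡⟨ ⊕-identityʳ i ⟩
    i               ∎
    where open ≡-Reasoning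

  rotation : Fin (suc m) → Permutation′ (suc m)
  rotation a = permutation (_⊕ a) (_⊕ ⊖ a) (λ j → ⊕-⊖-cancelʳ j a) (λ i → ⊖-⊕-cancelʳ i a)

module _ {n k : ℕ} (h : Fin (suc n) → Fin k) (h-mono : h Preserves _<_ ⟶ _<_) where

  strictMono⇒inflationary : ∀ i → toℕ i ℕ.≤ toℕ (h i)
  strictMono⇒inflationary = <-weakInduction (λ i → toℕ i ℕ.≤ toℕ (h i)) z≤n step
    where
      step : ∀ i → toℕ (inject₁ i) ℕ.≤ toℕ (h (inject₁ i)) → toℕ (suc i) ℕ.≤ toℕ (h (suc i))
      step i ih = ≤-<-trans (subst (ℕ._≤ toℕ (h (inject₁ i))) (toℕ-inject₁ i) ih)
                            (h-mono (≤̄⇒inject₁< ≤-refl))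

strictMono-inverses⇒id : ∀ {n} (g h : Fin (suc n) → Fin (suc n)) →
  g Preserves _<_ ⟶ _<_ → h Preserves _<_ ⟶ _<_ → (∀ i → h (g i) ≡ i) → ∀ i → g i ≡ i
strictMono-inverses⇒id g h g-mono h-mono h∘g≗id i = toℕ-injective (≤-antisym
  (subst (λ j → toℕ (g i) ℕ.≤ toℕ j) (h∘g≗id i) (strictMono⇒inflationary h h-mono (g i)))
  (strictMono⇒inflationary g g-mono i))

Precedes : ∀ {n} {A : Set} → (Fin n → A) → A → A → Set
Precedes {n} σ a b = Σ (Fin n) λ i → Σ (Fin n) λ j → (i < j) × (σ i ≡ a) × (σ j ≡ b)

module _ {n : ℕ} (π ρ : Permutation′ n) where

  Precedes-⊆⇒strictMono : (∀ a b → Precedes (π ⟨$⟩ʳ_) a b → Precedes (ρ ⟨$⟩ʳ_) a b) →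
                          (λ i → ρ ⟨$⟩ˡ (π ⟨$⟩ʳ i)) Preserves _<_ ⟶ _<_
  Precedes-⊆⇒strictMono ⊆ {i} {j} i<j with ⊆ _ _ (i , j , i<j , refl , refl)
  ... | p , q , p<q , ρp≡πi , ρq≡πj = subst₂ _<_ (back ρp≡πi) (back ρq≡πj) p<q
    where
      back : ∀ {x y} → ρ ⟨$⟩ʳ x ≡ y → x ≡ ρ ⟨$⟩ˡ y
      back refl = sym (inverseˡ ρ)

Precedes-injective : ∀ {m} (π ρ : Permutation′ (suc m)) →
                     SameSet (Precedes (π ⟨$⟩ʳ_)) (Precedes (ρ ⟨$⟩ʳ_)) → π ≈ ρ
Precedes-injective π ρ same i = begin
    π ⟨$⟩ʳ i                    ≡⟨ sym (inverseʳ ρ) ⟩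
    ρ ⟨$⟩ʳ (ρ ⟨$⟩ˡ (π ⟨$⟩ʳ i)) ≡⟨ cong (ρ ⟨$⟩ʳ_) (strictMono-inverses⇒id _ _ g-mono h-mono h∘g≗id i) ⟩
    ρ ⟨$⟩ʳ i                    ∎
  where
    open ≡-Reasoning
    g-mono : (λ j → ρ ⟨$⟩ˡ (π ⟨$⟩ʳ j)) Preserves _<_ ⟶ _<_
    g-mono = Precedes-⊆⇒strictMono π ρ (λ a b → proj₁ (same a b))
    h-mono : (λ j → π ⟨$⟩ˡ (ρ ⟨$⟩ʳ j)) Preserves _<_ ⟶ _<_
    h-mono = Precedes-⊆⇒strictMono ρ π (λ a b → proj₂ (same a b))
    h∘g≗id : ∀ j → π ⟨$⟩ˡ (ρ ⟨$⟩ʳ (ρ ⟨$⟩ˡ (π ⟨$⟩ʳ j))) ≡ j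
    h∘g≗id j = trans (cong (π ⟨$⟩ˡ_) (inverseʳ ρ)) (inverseˡ π)

module _ {m : ℕ} where

  startingAt : Listing (suc m) → Fin (suc m) → Permutation′ (suc m)
  startingAt τ k = rotation (τ ⟨$⟩ˡ k) ∘ₚ τ

  startAt-zero : ∀ (τ : Listing (suc m)) k → startAt τ k zero ≡ k
  startAt-zero τ k = trans (cong (τ ⟨$⟩ʳ_) (⊕-identityˡ (τ ⟨$⟩ˡ k))) (inverseʳ τ)

  rotations-agree⇒SameHCycle : ∀ (τ ν : Listing (suc m)) a b →
    (∀ i → at τ (i ⊕ a) ≡ at ν (i ⊕ b)) → SameHCycle τ ν
  rotations-agree⇒SameHCycle τ ν a b agree = b ⊕ ⊖ a , λ i → begin
    at τ i                  ≡⟨ cong (at τ) (sym (⊕-⊖-cancelʳ i a)) ⟩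
    at τ (i ⊕ ⊖ a ⊕ a)      ≡⟨ agree (i ⊕ ⊖ a) ⟩
    at ν (i ⊕ ⊖ a ⊕ b)      ≡⟨ cong (at ν) (⊕-assoc i (⊖ a) b) ⟩
    at ν (i ⊕ (⊖ a ⊕ b))    ≡⟨ cong (λ r → at ν (i ⊕ r)) (⊕-comm (⊖ a) b) ⟩
    at ν (i ⊕ (b ⊕ ⊖ a))    ∎
    where open ≡-Reasoning

proposition5p4 : (m : ℕ) → suc m ≥ 3 → (k₁ k₂ : Fin (suc m)) → (τ ν : Listing (suc m)) →
    (¬ (k₁ ≡ k₂) ⊎ ¬ SameHCycle τ ν) → ¬ SameSet (S τ k₁) (S ν k₂)
proposition5p4 m _ k₁ k₂ τ ν distinct sameS =
  [ (λ k₁≢k₂ → k₁≢k₂ k₁≡k₂) , (λ ¬sameHCycle → ¬sameHCycle sameHCycle) ] distinct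
  where
    -- S τ k unfolds to Precedes (startingAt τ k ⟨$⟩ʳ_).
    startingAt-agree : startingAt τ k₁ ≈ startingAt ν k₂
    startingAt-agree = Precedes-injective (startingAt τ k₁) (startingAt ν k₂) sameS

    k₁≡k₂ : k₁ ≡ k₂
    k₁≡k₂ = trans (sym (startAt-zero τ k₁)) (trans (startingAt-agree zero) (startAt-zero ν k₂))

    sameHCycle : SameHCycle τ ν
    sameHCycle = rotations-agree⇒SameHCycle τ ν (τ ⟨$⟩ˡ k₁) (ν ⟨$⟩ˡ k₂) startingAt-agree
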